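{- Let $\mathbb{A}$ be a reduct of a countably infinite homogeneous graph $\mathbb{H}=(A;E)$ preserved by a ternary canonical operation $h$ such that $h(N,\cdot,\cdot)=h(\cdot,N,\cdot)=h(\cdot,\cdot,N)=N$ and which behaves like a minority on $\{E,=\}$, i.e. $h(E,E,E)=h(E,=,=)=h(=,E,=)=h(=,=,E)=E$ and $h(=,=,=)=h(=,E,E)=h(E,=,E)=h(E,E,=)$ is $=$. Then $\mathbb{A}$ pp-defines none of the following: a $[(N(x_1,x_2)\Rightarrow E^{=}(x_3,x_4))]$-relation; a $[(N(x_1,x_2)\Rightarrow x_3=x_4)]$-relation; a $[(N(x_1,x_2)\Rightarrow E(x_3,x_4)),(E^{=}(x_3,x_4))]$-relation.
   Context: A countably infinite homogeneous graph is a countably infinite loopless undirected graph $\mathbb{H}=(A;E)$ in which every isomorphism between finite induced subgraphs extends to an automorphism; $N:=\{(a,b):a\ne b,(a,b)\notin E\}$; $E^{=}:=E\cup\{(a,a):a\in A\}$. The orbits of pairs under $\mathrm{Aut}(\mathbb{H})$ are $E$, $N$, $=$. A reduct of $\mathbb{H}$ is a structure on $A$ with finitely many relations each first-order definable in $\mathbb{H}$; it is preserved by $h$ if $h$ applied coordinatewise to tuples of any relation gives a tuple of that relation. pp-definable: definable from atomic formulas and equality using only conjunction and existential quantification. $h:A^3\to A$ is canonical if for all $m$, all $\alpha_1,\alpha_2,\alpha_3\in\mathrm{Aut}(\mathbb{H})$ and $m$-tuples $a_1,a_2,a_3$ there is $\beta\in\mathrm{Aut}(\mathbb{H})$ with $\beta(h(\alpha_1(a_1),\alpha_2(a_2),\alpha_3(a_3)))=h(a_1,a_2,a_3)$.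 Then for $O_1,O_2,O_3\in\{E,N,=\}$, $h(O_1,O_2,O_3)$ denotes the orbit of $(h(a_1,a_2,a_3),h(b_1,b_2,b_3))$ for any $(a_i,b_i)\in O_i$; $h(N,\cdot,\cdot)=N$ means $h(N,O_2,O_3)=N$ for all $O_2,O_3$, and similarly for the other positions. A quaternary $R$ entails $\varphi$ if all its tuples satisfy $\varphi$; it efficiently entails $(S_1(x_1,x_2)\Rightarrow S_2(x_3,x_4))$ if it entails it and contains $t_1$ with $(t_1[1],t_1[2])\in S_1,(t_1[3],t_1[4])\in S_2$ and $t_2$ with $(t_2[1],t_2[2])\notin S_1,(t_2[3],t_2[4])\notin S_2$. A $[(S_1\Rightarrow S_2)]$-relation efficiently entails the implication; a $[(S_1\Rightarrow S_2),(\varphi)]$-relation additionally entails $\varphi$. -}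

module Defs where

open import Data.Nat using (ℕ; suc)
open import Data.Fin using (Fin; zero; suc)
open import Data.Product using (Σ; ∃; _×_; _,_)
open import Data.Sum using (_⊎_)
open import Data.Empty using (⊥)
open import Relation.Nullary using (¬_)
open import Relation.Binary.PropositionalEquality using (_≡_; _≢_)
open import Function.Bundles using (_⇔_; _↔_)
open import Function.Definitions using (Bijective)

Tuple : Set → ℕ → Set
Tuple A n = Fin n → A

i1 i2 i3 i4 : Fin 4
i1 = zero
i2 = suc zero
i3 = suc (suc zero)
i4 = suc (suc (suc zero))

_▹_ : {A : Set} {n : ℕ} → A → Tuple A n → Tuple A (suc n)
(a ▹ ρ) zero = a
(a ▹ ρ) (suc j) = ρ j

data FO (n : ℕ) : Set where
  edge   : Fin n → Fin n → FO n
  eqf    : Fin n → Fin n → FO n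
  falsef : FO n
  notf   : FO n → FO n
  andf   : FO n → FO n → FO n
  orf    : FO n → FO n → FO n
  exf    : FO (suc n) → FO n
  allf   : FO (suc n) → FO n

module _ {A : Set} (E : A → A → Set) where

  SatFO : {n : ℕ} → FO n → Tuple A n → Set
  SatFO (edge i j) ρ = E (ρ i) (ρ j)
  SatFO (eqf i j) ρ = ρ i ≡ ρ j
  SatFO falsef ρ = ⊥
  SatFO (notf φ) ρ = ¬ SatFO φ ρ
  SatFO (andf φ ψ) ρ = SatFO φ ρ × SatFO ψ ρ
  SatFO (orf φ ψ) ρ = SatFO φ ρ ⊎ SatFO ψ ρ
  SatFO (exf φ) ρ = Σ A λ a → SatFO φ (a ▹ ρ)
  SatFO (allf φ) ρ = (a : A) → SatFO φ (a ▹ ρ)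

  FODefinable : {n : ℕ} → (Tuple A n → Set) → Set
  FODefinable {n} R = Σ (FO n) λ φ → (t : Tuple A n) → R t ⇔ SatFO φ t

  IsLooplessUndirected : Set
  IsLooplessUndirected = ((a : A) → ¬ E a a) × ((a b : A) → E a b → E b a)

  IsAut : (A → A) → Set
  IsAut f = Bijective _≡_ _≡_ f × ((a b : A) → E a b ⇔ E (f a) (f b))

  -- an isomorphism between finite induced subgraphs, given by
  -- enumerations a, b of the two vertex sets (a i ↦ b i)
  IsFinitePartialIso : {n : ℕ} → Tuple A n → Tuple A n → Set
  IsFinitePartialIso {n} a b =
    ((i j : Fin n) → a i ≡ a j ⇔ b i ≡ b j) ×
    ((i j : Fin n) → E (a i) (a j) ⇔ E (b i) (b j))

  IsHomogeneous : Set
  IsHomogeneous = (n : ℕ) (a b : Tuple A n) → IsFinitePartialIso a b →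
    Σ (A → A) λ α → IsAut α × ((i : Fin n) → α (a i) ≡ b i)

  IsCountablyInfiniteHomogeneousGraph : Set
  IsCountablyInfiniteHomogeneousGraph =
    (A ↔ ℕ) × IsLooplessUndirected × IsHomogeneous

  NRel : A → A → Set
  NRel a b = (a ≢ b) × ¬ E a b

  E= : A → A → Set
  E= a b = E a b ⊎ a ≡ b

data Orbit : Set where
  oE oN o= : Orbit

module _ {A : Set} (E : A → A → Set) where

  InOrbit : Orbit → A → A → Set
  InOrbit oE a b = E a b
  InOrbit oN a b = NRel E a b
  InOrbit o= a b = a ≡ b

  IsCanonical : (A → A → A → A) → Set
  IsCanonical h = (m : ℕ) (α₁ α₂ α₃ : A → A) → IsAut E α₁ → IsAut E α₂ → IsAut E α₃ →
    (a₁ a₂ a₃ : Tuple A m) →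
    Σ (A → A) λ β → IsAut E β ×
      ((j : Fin m) → β (h (α₁ (a₁ j)) (α₂ (a₂ j)) (α₃ (a₃ j))) ≡ h (a₁ j) (a₂ j) (a₃ j))

  -- h(O₁,O₂,O₃) = O  (for canonical h): the orbit of
  -- (h(a₁,a₂,a₃), h(b₁,b₂,b₃)) is O whenever (aᵢ,bᵢ) ∈ Oᵢ.
  Behaves : (A → A → A → A) → Orbit → Orbit → Orbit → Orbit → Set
  Behaves h O₁ O₂ O₃ O = (a₁ b₁ a₂ b₂ a₃ b₃ : A) →
    InOrbit O₁ a₁ b₁ → InOrbit O₂ a₂ b₂ → InOrbit O₃ a₃ b₃ →
    InOrbit O (h a₁ a₂ a₃) (h b₁ b₂ b₃)

  IsReduct : (k : ℕ) (ar : Fin k → ℕ) → ((i : Fin k) → Tuple A (ar i) → Set) → Set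
  IsReduct k ar Rel = (i : Fin k) → FODefinable E (Rel i)

Preserves : {A : Set} {n : ℕ} → (A → A → A → A) → (Tuple A n → Set) → Set
Preserves {A} {n} h R = (t₁ t₂ t₃ : Tuple A n) → R t₁ → R t₂ → R t₃ →
  R (λ j → h (t₁ j) (t₂ j) (t₃ j))

data PP (k : ℕ) (ar : Fin k → ℕ) (n : ℕ) : Set where
  relp : (i : Fin k) → (Fin (ar i) → Fin n) → PP k ar n
  eqp  : Fin n → Fin n → PP k ar n
  andp : PP k ar n → PP k ar n → PP k ar n
  exp  : PP k ar (suc n) → PP k ar n

module _ {A : Set} {k : ℕ} {ar : Fin k → ℕ} (Rel : (i : Fin k) → Tuple A (ar i) → Set) where

  SatPP : {n : ℕ} → PP k ar n → Tuple A n → Set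
  SatPP (relp i σ) ρ = Rel i (λ j → ρ (σ j))
  SatPP (eqp i j) ρ = ρ i ≡ ρ j
  SatPP (andp φ ψ) ρ = SatPP φ ρ × SatPP ψ ρ
  SatPP (exp φ) ρ = Σ A λ a → SatPP φ (a ▹ ρ)

  PPDefines : {n : ℕ} → (Tuple A n → Set) → Set
  PPDefines {n} R = Σ (PP k ar n) λ φ → (t : Tuple A n) → R t ⇔ SatPP φ t

module _ {A : Set} where

  -- R efficiently entails (S₁(x₁,x₂) ⇒ S₂(x₃,x₄)), i.e. R is a
  -- [(S₁ ⇒ S₂)]-relation
  EffEntails : (Tuple A 4 → Set) → (A → A → Set) → (A → A → Set) → Set
  EffEntails R S₁ S₂ =
    ((t : Tuple A 4) → R t → S₁ (t i1) (t i2) → S₂ (t i3) (t i4)) ×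
    (Σ (Tuple A 4) λ t₁ → R t₁ × S₁ (t₁ i1) (t₁ i2) × S₂ (t₁ i3) (t₁ i4)) ×
    (Σ (Tuple A 4) λ t₂ → R t₂ × ¬ S₁ (t₂ i1) (t₂ i2) × ¬ S₂ (t₂ i3) (t₂ i4))

  Entails34 : (Tuple A 4 → Set) → (A → A → Set) → Set
  Entails34 R S = (t : Tuple A 4) → R t → S (t i3) (t i4)

-- Every relation pp-definable in the reduct is preserved by h.  Given
-- witnesses t₁, t₂ of an efficient entailment (N(x₁,x₂) ⇒ S(x₃,x₄)), apply h
-- to t₁,t₂,t₁ (for S = E⁼) or to t₁,t₁,t₂ (for S = '=' and S = E).  On
-- (x₁,x₂) the result is in N, since N absorbs h in each argument; on (x₃,x₄)
-- it lands outside S, by absorption of N, resp. by the minority values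
-- h(=,=,E) = E and h(E,E,=) = '='.  The orbit of a pair is only available up
-- to double negation, which suffices because N and ≢ are negative.
module Submission where

open import Defs
open import Data.Nat using (ℕ)
open import Data.Fin using (Fin; zero; suc)
open import Data.Product using (∃; _×_; _,_; proj₁; proj₂)
open import Data.Sum using (_⊎_; inj₁; inj₂)
open import Data.Empty using (⊥-elim)
open import Relation.Nullary using (¬_)
open import Relation.Binary.PropositionalEquality
  using (_≡_; _≢_; _≗_; refl; sym; subst; subst₂)
open import Function.Bundles using (Equivalence)

map₃ : {A : Set} {n : ℕ} → (A → A → A → A) → Tuple A n → Tuple A n → Tuple A n → Tuple A n
map₃ h t₁ t₂ t₃ j = h (t₁ j) (t₂ j) (t₃ j)

▹-cong : {A : Set} {n : ℕ} {ρ ρ′ : Tuple A n} (a : A) → ρ ≗ ρ′ → (a ▹ ρ) ≗ (a ▹ ρ′)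
▹-cong a p zero = refl
▹-cong a p (suc j) = p j

module _ {A : Set} (E : A → A → Set) where

  SatFO-resp-≗ : {n : ℕ} (φ : FO n) {ρ ρ′ : Tuple A n} → ρ ≗ ρ′ → SatFO E φ ρ → SatFO E φ ρ′
  SatFO-resp-≗ (edge i j) p s = subst₂ E (p i) (p j) s
  SatFO-resp-≗ (eqf i j) p s = subst₂ _≡_ (p i) (p j) s
  SatFO-resp-≗ falsef p s = s
  SatFO-resp-≗ (notf φ) p s = λ s′ → s (SatFO-resp-≗ φ (λ j → sym (p j)) s′)
  SatFO-resp-≗ (andf φ ψ) p (s , t) = SatFO-resp-≗ φ p s , SatFO-resp-≗ ψ p t
  SatFO-resp-≗ (orf φ ψ) p (inj₁ s) = inj₁ (SatFO-resp-≗ φ p s)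
  SatFO-resp-≗ (orf φ ψ) p (inj₂ s) = inj₂ (SatFO-resp-≗ ψ p s)
  SatFO-resp-≗ (exf φ) p (a , s) = a , SatFO-resp-≗ φ (▹-cong a p) s
  SatFO-resp-≗ (allf φ) p s = λ a → SatFO-resp-≗ φ (▹-cong a p) (s a)

  FODefinable⇒resp-≗ : {n : ℕ} {R : Tuple A n → Set} → FODefinable E R →
    {t t′ : Tuple A n} → t ≗ t′ → R t → R t′
  FODefinable⇒resp-≗ (φ , d) {t} {t′} p r =
    Equivalence.from (d t′) (SatFO-resp-≗ φ p (Equivalence.to (d t) r))

module _ {A : Set} {k : ℕ} {ar : Fin k → ℕ} (Rel : (i : Fin k) → Tuple A (ar i) → Set)
         (Rel-resp-≗ : (i : Fin k) {t t′ : Tuple A (ar i)} → t ≗ t′ → Rel i t → Rel i t′)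
         where

  SatPP-resp-≗ : {n : ℕ} (φ : PP k ar n) {ρ ρ′ : Tuple A n} → ρ ≗ ρ′ → SatPP Rel φ ρ → SatPP Rel φ ρ′
  SatPP-resp-≗ (relp i σ) p s = Rel-resp-≗ i (λ j → p (σ j)) s
  SatPP-resp-≗ (eqp i j) p s = subst₂ _≡_ (p i) (p j) s
  SatPP-resp-≗ (andp φ ψ) p (s , t) = SatPP-resp-≗ φ p s , SatPP-resp-≗ ψ p t
  SatPP-resp-≗ (exp φ) p (a , s) = a , SatPP-resp-≗ φ (▹-cong a p) s

  module _ (h : A → A → A → A) (pres : (i : Fin k) → Preserves h (Rel i)) where

    SatPP-preserved : {n : ℕ} (φ : PP k ar n) → Preserves h (SatPP Rel φ)
    SatPP-preserved (relp i σ) ρ₁ ρ₂ ρ₃ s₁ s₂ s₃ = pres i _ _ _ s₁ s₂ s₃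
    SatPP-preserved (eqp i j) ρ₁ ρ₂ ρ₃ s₁ s₂ s₃ rewrite s₁ | s₂ | s₃ = refl
    SatPP-preserved (andp φ ψ) ρ₁ ρ₂ ρ₃ (s₁ , t₁) (s₂ , t₂) (s₃ , t₃) =
      SatPP-preserved φ ρ₁ ρ₂ ρ₃ s₁ s₂ s₃ , SatPP-preserved ψ ρ₁ ρ₂ ρ₃ t₁ t₂ t₃
    SatPP-preserved (exp φ) ρ₁ ρ₂ ρ₃ (a₁ , s₁) (a₂ , s₂) (a₃ , s₃) =
      h a₁ a₂ a₃ , SatPP-resp-≗ φ commute (SatPP-preserved φ _ _ _ s₁ s₂ s₃)
      where
      commute : map₃ h (a₁ ▹ ρ₁) (a₂ ▹ ρ₂) (a₃ ▹ ρ₃) ≗ (h a₁ a₂ a₃ ▹ map₃ h ρ₁ ρ₂ ρ₃)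
      commute zero = refl
      commute (suc j) = refl

    PPDefines⇒Preserves : {n : ℕ} {R : Tuple A n → Set} → PPDefines Rel R → Preserves h R
    PPDefines⇒Preserves (φ , d) t₁ t₂ t₃ r₁ r₂ r₃ = Equivalence.from (d _)
      (SatPP-preserved φ t₁ t₂ t₃ (Equivalence.to (d _) r₁) (Equivalence.to (d _) r₂) (Equivalence.to (d _) r₃))

module _ {A : Set} (E : A → A → Set) where

  orbit-¬¬ : (a b : A) → ¬ ¬ ∃ λ O → InOrbit E O a b
  orbit-¬¬ a b noOrbit = noOrbit (oN , (λ a≡b → noOrbit (o= , a≡b)) , (λ e → noOrbit (oE , e)))

  NRel-from-any-orbits : {a b c d x y : A} →
    ((O O′ : Orbit) → InOrbit E O a b → InOrbit E O′ c d → NRel E x y) → NRel E x y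
  NRel-from-any-orbits {a} {b} {c} {d} f =
    (λ x≡y → orbit-¬¬ a b λ (O , o) → orbit-¬¬ c d λ (O′ , o′) → proj₁ (f O O′ o o′) x≡y) ,
    (λ e → orbit-¬¬ a b λ (O , o) → orbit-¬¬ c d λ (O′ , o′) → proj₂ (f O O′ o o′) e)

  ¬E=⇒NRel : {a b : A} → ¬ E= E a b → NRel E a b
  ¬E=⇒NRel ¬e= = (λ a≡b → ¬e= (inj₂ a≡b)) , (λ e → ¬e= (inj₁ e))

  NRel⇒¬E= : {a b : A} → NRel E a b → ¬ E= E a b
  NRel⇒¬E= (a≢b , ¬e) (inj₁ e) = ¬e e
  NRel⇒¬E= (a≢b , ¬e) (inj₂ a≡b) = a≢b a≡b

  module _ (h : A → A → A → A) where

    NRel-h₁ : ((O₂ O₃ : Orbit) → Behaves E h oN O₂ O₃ oN) →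
      {a₁ b₁ a₂ b₂ a₃ b₃ : A} → NRel E a₁ b₁ → NRel E (h a₁ a₂ a₃) (h b₁ b₂ b₃)
    NRel-h₁ N-absorbs₁ n = NRel-from-any-orbits λ O₂ O₃ → N-absorbs₁ O₂ O₃ _ _ _ _ _ _ n

    NRel-h₂ : ((O₁ O₃ : Orbit) → Behaves E h O₁ oN O₃ oN) →
      {a₁ b₁ a₂ b₂ a₃ b₃ : A} → NRel E a₂ b₂ → NRel E (h a₁ a₂ a₃) (h b₁ b₂ b₃)
    NRel-h₂ N-absorbs₂ n = NRel-from-any-orbits λ O₁ O₃ o₁ → N-absorbs₂ O₁ O₃ _ _ _ _ _ _ o₁ n

    NRel-h₃ : ((O₁ O₂ : Orbit) → Behaves E h O₁ O₂ oN oN) →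
      {a₁ b₁ a₂ b₂ a₃ b₃ : A} → NRel E a₃ b₃ → NRel E (h a₁ a₂ a₃) (h b₁ b₂ b₃)
    NRel-h₃ N-absorbs₃ n = NRel-from-any-orbits λ O₁ O₂ o₁ o₂ → N-absorbs₃ O₁ O₂ _ _ _ _ _ _ o₁ o₂ n

    module _ {R : Tuple A 4 → Set} (preserved : Preserves h R)
             (N-absorbs₁ : (O₂ O₃ : Orbit) → Behaves E h oN O₂ O₃ oN) where

      ¬EffEntails-N⇒E= : ((O₁ O₃ : Orbit) → Behaves E h O₁ oN O₃ oN) → ¬ EffEntails R (NRel E) (E= E)
      ¬EffEntails-N⇒E= N-absorbs₂ (entails , (t₁ , r₁ , n₁ , _) , (t₂ , r₂ , _ , ¬e=₂)) =
        NRel⇒¬E= (NRel-h₂ N-absorbs₂ (¬E=⇒NRel ¬e=₂))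
          (entails _ (preserved t₁ t₂ t₁ r₁ r₂ r₁) (NRel-h₁ N-absorbs₁ n₁))

      ¬EffEntails-N⇒≡ : ((a : A) → ¬ E a a) → ((O₁ O₂ : Orbit) → Behaves E h O₁ O₂ oN oN) →
        Behaves E h o= o= oE oE → ¬ EffEntails R (NRel E) _≡_
      ¬EffEntails-N⇒≡ irrefl N-absorbs₃ h==E≡E (entails , (t₁ , r₁ , n₁ , q₁) , (t₂ , r₂ , _ , ≢₂)) =
        h-≢ (entails _ (preserved t₁ t₁ t₂ r₁ r₁ r₂) (NRel-h₁ N-absorbs₁ n₁))
        where
        h-≢ : h (t₁ i3) (t₁ i3) (t₂ i3) ≢ h (t₁ i4) (t₁ i4) (t₂ i4)
        h-≢ q = orbit-¬¬ (t₂ i3) (t₂ i4) λ where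
          (oE , e) → irrefl _ (subst (E _) (sym q) (h==E≡E _ _ _ _ _ _ q₁ q₁ e))
          (oN , n) → proj₁ (NRel-h₃ N-absorbs₃ n) q
          (o= , q₂) → ≢₂ q₂

      ¬EffEntails-N⇒E : ((a : A) → ¬ E a a) → Behaves E h oE oE o= o= →
        EffEntails R (NRel E) E → ¬ Entails34 R (E= E)
      ¬EffEntails-N⇒E irrefl hEE=≡= (entails , (t₁ , r₁ , n₁ , e₁) , (t₂ , r₂ , _ , ¬e₂)) entails34 =
        irrefl _ (subst (E _) (sym h-≡) (entails _ (preserved t₁ t₁ t₂ r₁ r₁ r₂) (NRel-h₁ N-absorbs₁ n₁)))
        where
        q₂ : t₂ i3 ≡ t₂ i4
        q₂ with entails34 t₂ r₂
        ... | inj₁ e₂ = ⊥-elim (¬e₂ e₂)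
        ... | inj₂ q = q
        h-≡ : h (t₁ i3) (t₁ i3) (t₂ i3) ≡ h (t₁ i4) (t₁ i4) (t₂ i4)
        h-≡ = hEE=≡= _ _ _ _ _ _ e₁ e₁ q₂

mainTheorem15 : {A : Set} (E : A → A → Set) →
    IsCountablyInfiniteHomogeneousGraph E →
    (k : ℕ) (ar : Fin k → ℕ) (Rel : (i : Fin k) → Tuple A (ar i) → Set) →
    IsReduct E k ar Rel →
    (h : A → A → A → A) →
    IsCanonical E h →
    ((i : Fin k) → Preserves h (Rel i)) →
    ((O₂ O₃ : Orbit) → Behaves E h oN O₂ O₃ oN) →
    ((O₁ O₃ : Orbit) → Behaves E h O₁ oN O₃ oN) →
    ((O₁ O₂ : Orbit) → Behaves E h O₁ O₂ oN oN) →
    Behaves E h oE oE oE oE → Behaves E h oE o= o= oE →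
    Behaves E h o= oE o= oE → Behaves E h o= o= oE oE →
    Behaves E h o= o= o= o= → Behaves E h o= oE oE o= →
    Behaves E h oE o= oE o= → Behaves E h oE oE o= o= →
    ((R : Tuple A 4 → Set) →
       EffEntails R (NRel E) (E= E) → ¬ PPDefines Rel R)
    × ((R : Tuple A 4 → Set) →
       EffEntails R (NRel E) _≡_ → ¬ PPDefines Rel R)
    × ((R : Tuple A 4 → Set) →
       EffEntails R (NRel E) E → Entails34 R (E= E) → ¬ PPDefines Rel R)
mainTheorem15 E (_ , (irrefl , _) , _) k ar Rel reduct h _ pres
  N-absorbs₁ N-absorbs₂ N-absorbs₃ _ _ _ h==E≡E _ _ _ hEE=≡= =
  (λ R eff def → ¬EffEntails-N⇒E= E h (preserved def) N-absorbs₁ N-absorbs₂ eff) ,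
  (λ R eff def → ¬EffEntails-N⇒≡ E h (preserved def) N-absorbs₁ irrefl N-absorbs₃ h==E≡E eff) ,
  (λ R eff entails34 def → ¬EffEntails-N⇒E E h (preserved def) N-absorbs₁ irrefl hEE=≡= eff entails34)
  where
  preserved : {R : Tuple _ 4 → Set} → PPDefines Rel R → Preserves h R
  preserved = PPDefines⇒Preserves Rel (λ i → FODefinable⇒resp-≗ E (reduct i)) h pres
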